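{- For lattice points $P,Q\in\mathbb{Z}^2$ define the taxicab distance $d_M(P,Q)$ as the minimum $k\ge0$ such that $\varphi_1\circ\cdots\circ\varphi_k(P)=Q$ with each $\varphi_j\in\mathcal{M}=\{M',M'',M''',M^{iv}\}$, where $M'(x,y)=(x+1,y)$, $M''(x,y)=(x-1,y)$, $M'''(x,y)=(x,y+1)$, $M^{iv}(x,y)=(x,y-1)$; and define the parabolic-taxicab distance $d_{pc}(P,Q)$ as the minimum $k\ge0$ such that $\varphi_1\circ\cdots\circ\varphi_k(P)=Q$ with each $\varphi_j\in\mathcal{M}\cup\{L',L''\}$, where $L'(x,y)=(-x+2y+1,y)$ and $L''(x,y)=(x,2x-y+1)$ (the empty composition being the identity). Let $d_E$ denote the Euclidean distance. Then: (1) $d_{pc}$ is a distance (metric) on $\mathbb{Z}^2$; (2) $d_E(P,Q)\le d_M(P,Q)$; (3) $d_{pc}(P,Q)\le d_M(P,Q)$, for all lattice points $P,Q\in\mathbb{Z}^2$. -}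

module Defs where

open import Data.Nat using (ℕ; _≤_; _+_)
open import Data.Integer as ℤ using (ℤ; +_; -_) renaming (_+_ to _+ℤ_; _-_ to _-ℤ_; _*_ to _*ℤ_)
open import Data.Product using (_×_; _,_; ∃)
open import Data.List using (List; []; _∷_; length)
open import Relation.Binary.PropositionalEquality using (_≡_)

Point : Set
Point = ℤ × ℤ

data MMove : Set where
  M′ M″ M‴ Miv : MMove

⟦_⟧M : MMove → Point → Point
⟦ M′  ⟧M (x , y) = (x +ℤ + 1 , y)
⟦ M″  ⟧M (x , y) = (x -ℤ + 1 , y)
⟦ M‴  ⟧M (x , y) = (x , y +ℤ + 1)
⟦ Miv ⟧M (x , y) = (x , y -ℤ + 1)

data PCMove : Set where
  mv  : MMove → PCMove
  L′  : PCMove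
  L″  : PCMove

⟦_⟧PC : PCMove → Point → Point
⟦ mv m ⟧PC P = ⟦ m ⟧M P
⟦ L′ ⟧PC (x , y) = ((- x) +ℤ (+ 2) *ℤ y +ℤ + 1 , y)
⟦ L″ ⟧PC (x , y) = (x , (+ 2) *ℤ x -ℤ y +ℤ + 1)

applyM : List MMove → Point → Point
applyM []       P = P
applyM (φ ∷ φs) P = ⟦ φ ⟧M (applyM φs P)

applyPC : List PCMove → Point → Point
applyPC []       P = P
applyPC (φ ∷ φs) P = ⟦ φ ⟧PC (applyPC φs P)

IsDM : Point → Point → ℕ → Set
IsDM P Q k =
  (∃ λ (φs : List MMove) → length φs ≡ k × applyM φs P ≡ Q)
  × (∀ (φs : List MMove) → applyM φs P ≡ Q → k ≤ length φs)

IsDpc : Point → Point → ℕ → Set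
IsDpc P Q k =
  (∃ λ (φs : List PCMove) → length φs ≡ k × applyPC φs P ≡ Q)
  × (∀ (φs : List PCMove) → applyPC φs P ≡ Q → k ≤ length φs)

dE² : Point → Point → ℤ
dE² (x₁ , y₁) (x₂ , y₂) = (x₁ -ℤ x₂) *ℤ (x₁ -ℤ x₂) +ℤ (y₁ -ℤ y₂) *ℤ (y₁ -ℤ y₂)

-- d_pc is a metric on ℤ² (values in ℕ, so nonnegativity is automatic)
IsMetricDpc : Set
IsMetricDpc =
  (∀ P Q → ∃ λ k → IsDpc P Q k)
  × (∀ P Q k → IsDpc P Q k → (k ≡ 0 → P ≡ Q) × (P ≡ Q → k ≡ 0))
  × (∀ P Q k → IsDpc P Q k → IsDpc Q P k)
  × (∀ P Q R a b c → IsDpc P Q a → IsDpc Q R b → IsDpc P R c → c ≤ a + b)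

{-# OPTIONS --safe #-}
-- Every move has an inverse move (the translations pairwise, while L′ and L″
-- are involutions), so reversing a word and inverting its letters gives
-- symmetry of d_pc, and concatenating words gives the triangle inequality.
-- The taxicab moves alone connect any two lattice points; as there are only
-- finitely many moves, reachability in exactly k moves is decidable, so a
-- least connecting length exists.  Taxicab words are parabolic-taxicab words,
-- which gives (3); and a taxicab move changes ∣Δx∣ + ∣Δy∣ by at most one,
-- while d_E² = ∣Δx∣² + ∣Δy∣² ≤ (∣Δx∣ + ∣Δy∣)², which gives (2).
module Submission where

open import Defs
open import Data.Nat using (ℕ; _≤_)
open import Data.Integer using (+_) renaming (_*_ to _*ℤ_; _≤_ to _≤ℤ_)
open import Data.Product using (_×_)

open import Data.Nat as ℕ using (zero; suc; _+_; _*_; _<_)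
import Data.Nat.Properties as ℕ
open import Data.Nat.Induction using (<-rec)
open import Data.Integer as ℤ using (ℤ; -[1+_]; ∣_∣; +≤+) renaming (_+_ to _+ℤ_; _-_ to _-ℤ_)
import Data.Integer.Properties as ℤ
open import Data.Integer.Tactic.RingSolver using (solve-∀)
open import Data.Product using (_,_; ∃)
open import Data.Product.Properties using (≡-dec)
open import Data.List using (List; []; _∷_; [_]; length; _++_; map; reverse; replicate)
import Data.List.Properties as List
open import Data.List.Relation.Unary.Any using (here; there; any?; satisfied)
open import Data.List.Membership.Propositional using (_∈_; lose)
open import Relation.Nullary using (Dec; yes; no)
open import Relation.Nullary.Decidable using (map′)
open import Relation.Unary using (Pred; Decidable)
open import Relation.Binary.PropositionalEquality using (_≡_; refl; sym; trans; cong; cong₂; subst; module ≡-Reasoning)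

module _ {p} {P : Pred ℕ p} (P? : Decidable P) where

  least-witness : ∀ n → P n → ∃ λ k → P k × (∀ m → P m → k ≤ m)
  least-witness = <-rec _ step
    where
    step : ∀ n → (∀ {m} → m < n → P m → ∃ λ k → P k × (∀ m → P m → k ≤ m))
         → P n → ∃ λ k → P k × (∀ m → P m → k ≤ m)
    step n rec Pn with ℕ.anyUpTo? P? n
    ... | yes (m , m<n , Pm) = rec m<n Pm
    ... | no  none           = n , Pn , λ m Pm → ℕ.≮⇒≥ (λ m<n → none (m , m<n , Pm))

inv : PCMove → PCMove
inv (mv M′)  = mv M″
inv (mv M″)  = mv M′
inv (mv M‴)  = mv Miv
inv (mv Miv) = mv M‴
inv L′       = L′
inv L″       = L″

inv-involutive : ∀ φ → inv (inv φ) ≡ φ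
inv-involutive (mv M′)  = refl
inv-involutive (mv M″)  = refl
inv-involutive (mv M‴)  = refl
inv-involutive (mv Miv) = refl
inv-involutive L′       = refl
inv-involutive L″       = refl

i+j-j≡i : ∀ i j → i +ℤ j -ℤ j ≡ i
i+j-j≡i = solve-∀

i-j+j≡i : ∀ i j → i -ℤ j +ℤ j ≡ i
i-j+j≡i = solve-∀

inv-inverseˡ : ∀ φ P → ⟦ inv φ ⟧PC (⟦ φ ⟧PC P) ≡ P
inv-inverseˡ (mv M′)  (x , y) = cong (_, y) (i+j-j≡i x (+ 1))
inv-inverseˡ (mv M″)  (x , y) = cong (_, y) (i-j+j≡i x (+ 1))
inv-inverseˡ (mv M‴)  (x , y) = cong (x ,_) (i+j-j≡i y (+ 1))
inv-inverseˡ (mv Miv) (x , y) = cong (x ,_) (i-j+j≡i y (+ 1))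
inv-inverseˡ L′       (x , y) = cong (_, y) (L′-involutive x y)
  where L′-involutive : ∀ x y → ℤ.- (ℤ.- x +ℤ + 2 *ℤ y +ℤ + 1) +ℤ + 2 *ℤ y +ℤ + 1 ≡ x
        L′-involutive = solve-∀
inv-inverseˡ L″       (x , y) = cong (x ,_) (L″-involutive x y)
  where L″-involutive : ∀ x y → + 2 *ℤ x -ℤ (+ 2 *ℤ x -ℤ y +ℤ + 1) +ℤ + 1 ≡ y
        L″-involutive = solve-∀

inv-inverseʳ : ∀ φ P → ⟦ φ ⟧PC (⟦ inv φ ⟧PC P) ≡ P
inv-inverseʳ φ P = subst (λ ψ → ⟦ ψ ⟧PC (⟦ inv φ ⟧PC P) ≡ P) (inv-involutive φ) (inv-inverseˡ (inv φ) P)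

applyPC-++ : ∀ φs ψs P → applyPC (φs ++ ψs) P ≡ applyPC φs (applyPC ψs P)
applyPC-++ []       ψs P = refl
applyPC-++ (φ ∷ φs) ψs P = cong ⟦ φ ⟧PC (applyPC-++ φs ψs P)

inverse : List PCMove → List PCMove
inverse φs = reverse (map inv φs)

length-inverse : ∀ φs → length (inverse φs) ≡ length φs
length-inverse φs = trans (List.length-reverse (map inv φs)) (List.length-map inv φs)

applyPC-inverseˡ : ∀ φs P → applyPC (inverse φs) (applyPC φs P) ≡ P
applyPC-inverseˡ []       P = refl
applyPC-inverseˡ (φ ∷ φs) P = begin
  applyPC (inverse (φ ∷ φs)) (⟦ φ ⟧PC (applyPC φs P))
    ≡⟨ cong (λ ψs → applyPC ψs (⟦ φ ⟧PC (applyPC φs P))) (List.unfold-reverse (inv φ) (map inv φs)) ⟩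
  applyPC (inverse φs ++ [ inv φ ]) (⟦ φ ⟧PC (applyPC φs P))
    ≡⟨ applyPC-++ (inverse φs) [ inv φ ] _ ⟩
  applyPC (inverse φs) (⟦ inv φ ⟧PC (⟦ φ ⟧PC (applyPC φs P)))
    ≡⟨ cong (applyPC (inverse φs)) (inv-inverseˡ φ _) ⟩
  applyPC (inverse φs) (applyPC φs P)
    ≡⟨ applyPC-inverseˡ φs P ⟩
  P ∎
  where open ≡-Reasoning

PathPC : Point → Point → ℕ → Set
PathPC P Q k = ∃ λ (φs : List PCMove) → length φs ≡ k × applyPC φs P ≡ Q

allMoves : List PCMove
allMoves = mv M′ ∷ mv M″ ∷ mv M‴ ∷ mv Miv ∷ L′ ∷ L″ ∷ []

∈-allMoves : ∀ φ → φ ∈ allMoves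
∈-allMoves (mv M′)  = here refl
∈-allMoves (mv M″)  = there (here refl)
∈-allMoves (mv M‴)  = there (there (here refl))
∈-allMoves (mv Miv) = there (there (there (here refl)))
∈-allMoves L′       = there (there (there (there (here refl))))
∈-allMoves L″       = there (there (there (there (there (here refl)))))

∃-move? : ∀ {p} {F : Pred PCMove p} → Decidable F → Dec (∃ F)
∃-move? F? = map′ satisfied (λ (φ , Fφ) → lose (∈-allMoves φ) Fφ) (any? F? allMoves)

_≟_ : (P Q : Point) → Dec (P ≡ Q)
_≟_ = ≡-dec ℤ._≟_ ℤ._≟_

pathPC? : ∀ P Q k → Dec (PathPC P Q k)
pathPC? P Q zero    = map′ (λ P≡Q → [] , refl , P≡Q) (λ { ([] , _ , P≡Q) → P≡Q }) (P ≟ Q)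
pathPC? P Q (suc k) = map′ extend shorten (∃-move? (λ φ → pathPC? P (⟦ inv φ ⟧PC Q) k))
  where
  extend : (∃ λ φ → PathPC P (⟦ inv φ ⟧PC Q) k) → PathPC P Q (suc k)
  extend (φ , ψs , refl , reach) = φ ∷ ψs , refl , trans (cong ⟦ φ ⟧PC reach) (inv-inverseʳ φ Q)
  shorten : PathPC P Q (suc k) → ∃ λ φ → PathPC P (⟦ inv φ ⟧PC Q) k
  shorten (φ ∷ ψs , refl , reach) = φ , ψs , refl , trans (sym (inv-inverseˡ φ _)) (cong ⟦ inv φ ⟧PC reach)

applyM-++ : ∀ φs ψs P → applyM (φs ++ ψs) P ≡ applyM φs (applyM ψs P)
applyM-++ []       ψs P = refl
applyM-++ (φ ∷ φs) ψs P = cong ⟦ φ ⟧M (applyM-++ φs ψs P)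

i+n+1≡i+[1+n] : ∀ i n → i +ℤ + n +ℤ + 1 ≡ i +ℤ + suc n
i+n+1≡i+[1+n] i n = trans (ℤ.+-assoc i (+ n) (+ 1)) (cong (λ m → i +ℤ + m) (ℕ.+-comm n 1))

i-n-1≡i-[1+n] : ∀ i n → i -ℤ + n -ℤ + 1 ≡ i -ℤ + suc n
i-n-1≡i-[1+n] i n = begin
  i -ℤ + n -ℤ + 1           ≡⟨ ℤ.+-assoc i (ℤ.- + n) (ℤ.- + 1) ⟩
  i +ℤ (ℤ.- + n -ℤ + 1)     ≡⟨ cong (i +ℤ_) (ℤ.neg-distrib-+ (+ n) (+ 1)) ⟨
  i -ℤ (+ n +ℤ + 1)         ≡⟨ cong (λ m → i -ℤ + m) (ℕ.+-comm n 1) ⟩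
  i -ℤ + suc n              ∎
  where open ≡-Reasoning

applyM-replicate-M′ : ∀ n x y → applyM (replicate n M′) (x , y) ≡ (x +ℤ + n , y)
applyM-replicate-M′ zero    x y = cong (_, y) (sym (ℤ.+-identityʳ x))
applyM-replicate-M′ (suc n) x y =
  trans (cong ⟦ M′ ⟧M (applyM-replicate-M′ n x y)) (cong (_, y) (i+n+1≡i+[1+n] x n))

applyM-replicate-M″ : ∀ n x y → applyM (replicate n M″) (x , y) ≡ (x -ℤ + n , y)
applyM-replicate-M″ zero    x y = cong (_, y) (sym (ℤ.+-identityʳ x))
applyM-replicate-M″ (suc n) x y =
  trans (cong ⟦ M″ ⟧M (applyM-replicate-M″ n x y)) (cong (_, y) (i-n-1≡i-[1+n] x n))

applyM-replicate-M‴ : ∀ n x y → applyM (replicate n M‴) (x , y) ≡ (x , y +ℤ + n)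
applyM-replicate-M‴ zero    x y = cong (x ,_) (sym (ℤ.+-identityʳ y))
applyM-replicate-M‴ (suc n) x y =
  trans (cong ⟦ M‴ ⟧M (applyM-replicate-M‴ n x y)) (cong (x ,_) (i+n+1≡i+[1+n] y n))

applyM-replicate-Miv : ∀ n x y → applyM (replicate n Miv) (x , y) ≡ (x , y -ℤ + n)
applyM-replicate-Miv zero    x y = cong (x ,_) (sym (ℤ.+-identityʳ y))
applyM-replicate-Miv (suc n) x y =
  trans (cong ⟦ Miv ⟧M (applyM-replicate-Miv n x y)) (cong (x ,_) (i-n-1≡i-[1+n] y n))

shiftˣ : ∀ d x y → ∃ λ (φs : List MMove) → applyM φs (x , y) ≡ (x +ℤ d , y)
shiftˣ (+ n)    x y = replicate n M′ , applyM-replicate-M′ n x y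
shiftˣ -[1+ n ] x y = replicate (suc n) M″ , applyM-replicate-M″ (suc n) x y

shiftʸ : ∀ d x y → ∃ λ (φs : List MMove) → applyM φs (x , y) ≡ (x , y +ℤ d)
shiftʸ (+ n)    x y = replicate n M‴ , applyM-replicate-M‴ n x y
shiftʸ -[1+ n ] x y = replicate (suc n) Miv , applyM-replicate-Miv (suc n) x y

i+[j-i]≡j : ∀ i j → i +ℤ (j -ℤ i) ≡ j
i+[j-i]≡j = solve-∀

pathM : ∀ P Q → ∃ λ (φs : List MMove) → applyM φs P ≡ Q
pathM (x₁ , y₁) (x₂ , y₂) with shiftˣ (x₂ -ℤ x₁) x₁ y₁ | shiftʸ (y₂ -ℤ y₁) x₂ y₁
... | φs , shiftx | ψs , shifty = ψs ++ φs , (begin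
  applyM (ψs ++ φs) (x₁ , y₁)       ≡⟨ applyM-++ ψs φs _ ⟩
  applyM ψs (applyM φs (x₁ , y₁))   ≡⟨ cong (applyM ψs) (trans shiftx (cong (_, y₁) (i+[j-i]≡j x₁ x₂))) ⟩
  applyM ψs (x₂ , y₁)               ≡⟨ trans shifty (cong (x₂ ,_) (i+[j-i]≡j y₁ y₂)) ⟩
  (x₂ , y₂)                         ∎)
  where open ≡-Reasoning

applyPC-map-mv : ∀ φs P → applyPC (map mv φs) P ≡ applyM φs P
applyPC-map-mv []       P = refl
applyPC-map-mv (φ ∷ φs) P = cong ⟦ φ ⟧M (applyPC-map-mv φs P)

isDpc-exists : ∀ P Q → ∃ (IsDpc P Q)
isDpc-exists P Q =
  let φs , reach = pathM P Q
      k , path , least = least-witness (pathPC? P Q) (length (map mv φs))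
                                       (map mv φs , refl , trans (applyPC-map-mv φs P) reach)
  in k , path , λ ψs reach′ → least (length ψs) (ψs , refl , reach′)

isDpc-zero : ∀ P Q k → IsDpc P Q k → (k ≡ 0 → P ≡ Q) × (P ≡ Q → k ≡ 0)
isDpc-zero P Q k ((φs , length≡k , reach) , least) =
  from-zero φs length≡k reach , λ P≡Q → ℕ.n≤0⇒n≡0 (least [] P≡Q)
  where
  from-zero : ∀ φs → length φs ≡ k → applyPC φs P ≡ Q → k ≡ 0 → P ≡ Q
  from-zero []      _ reach _ = reach
  from-zero (_ ∷ _) refl _ ()

isDpc-sym : ∀ P Q k → IsDpc P Q k → IsDpc Q P k
isDpc-sym P Q k ((φs , length≡k , refl) , least) =
  (inverse φs , trans (length-inverse φs) length≡k , applyPC-inverseˡ φs P) ,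
  λ ψs reach → subst (k ≤_) (length-inverse ψs) (least (inverse ψs) (reversed ψs reach))
  where
  reversed : ∀ ψs → applyPC ψs (applyPC φs P) ≡ P → applyPC (inverse ψs) P ≡ applyPC φs P
  reversed ψs reach = subst (λ R → applyPC (inverse ψs) R ≡ applyPC φs P) reach (applyPC-inverseˡ ψs _)

isDpc-triangle : ∀ P Q R a b c → IsDpc P Q a → IsDpc Q R b → IsDpc P R c → c ≤ a + b
isDpc-triangle P Q R a b c ((φs , refl , refl) , _) ((ψs , refl , refl) , _) (_ , least) =
  subst (c ≤_) (trans (List.length-++ ψs) (ℕ.+-comm (length ψs) (length φs)))
    (least (ψs ++ φs) (applyPC-++ ψs φs P))

isMetricDpc : IsMetricDpc
isMetricDpc = isDpc-exists , isDpc-zero , isDpc-sym , isDpc-triangle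

dpc≤dM : ∀ P Q a b → IsDpc P Q a → IsDM P Q b → a ≤ b
dpc≤dM P Q a b (_ , least) ((φs , refl , reach) , _) =
  subst (a ≤_) (List.length-map mv φs) (least (map mv φs) (trans (applyPC-map-mv φs P) reach))

taxicab : Point → Point → ℕ
taxicab (x₁ , y₁) (x₂ , y₂) = ∣ x₁ -ℤ x₂ ∣ + ∣ y₁ -ℤ y₂ ∣

taxicab-refl : ∀ P → taxicab P P ≡ 0
taxicab-refl (x , y) = cong₂ (λ u v → ∣ u ∣ + ∣ v ∣) (ℤ.+-inverseʳ x) (ℤ.+-inverseʳ y)

∣i-[j+k]∣≤∣k∣+∣i-j∣ : ∀ i j k → ∣ i -ℤ (j +ℤ k) ∣ ≤ ∣ k ∣ + ∣ i -ℤ j ∣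
∣i-[j+k]∣≤∣k∣+∣i-j∣ i j k = begin
  ∣ i -ℤ (j +ℤ k) ∣       ≡⟨ cong ∣_∣ (i-[j+k]≡i-j-k i j k) ⟩
  ∣ i -ℤ j -ℤ k ∣         ≤⟨ ℤ.∣i-j∣≤∣i∣+∣j∣ (i -ℤ j) k ⟩
  ∣ i -ℤ j ∣ + ∣ k ∣      ≡⟨ ℕ.+-comm ∣ i -ℤ j ∣ ∣ k ∣ ⟩
  ∣ k ∣ + ∣ i -ℤ j ∣      ∎
  where
  open ℕ.≤-Reasoning
  i-[j+k]≡i-j-k : ∀ i j k → i -ℤ (j +ℤ k) ≡ i -ℤ j -ℤ k
  i-[j+k]≡i-j-k = solve-∀

taxicab-step : ∀ m P R → taxicab P (⟦ m ⟧M R) ≤ suc (taxicab P R)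
taxicab-step M′  (x₁ , y₁) (x₂ , y₂) = ℕ.+-monoˡ-≤ ∣ y₁ -ℤ y₂ ∣ (∣i-[j+k]∣≤∣k∣+∣i-j∣ x₁ x₂ (+ 1))
taxicab-step M″  (x₁ , y₁) (x₂ , y₂) = ℕ.+-monoˡ-≤ ∣ y₁ -ℤ y₂ ∣ (∣i-[j+k]∣≤∣k∣+∣i-j∣ x₁ x₂ (ℤ.- + 1))
taxicab-step M‴  (x₁ , y₁) (x₂ , y₂) =
  ℕ.≤-trans (ℕ.+-monoʳ-≤ ∣ x₁ -ℤ x₂ ∣ (∣i-[j+k]∣≤∣k∣+∣i-j∣ y₁ y₂ (+ 1))) (ℕ.≤-reflexive (ℕ.+-suc _ _))
taxicab-step Miv (x₁ , y₁) (x₂ , y₂) =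
  ℕ.≤-trans (ℕ.+-monoʳ-≤ ∣ x₁ -ℤ x₂ ∣ (∣i-[j+k]∣≤∣k∣+∣i-j∣ y₁ y₂ (ℤ.- + 1))) (ℕ.≤-reflexive (ℕ.+-suc _ _))

taxicab-applyM : ∀ φs P → taxicab P (applyM φs P) ≤ length φs
taxicab-applyM []       P = ℕ.≤-reflexive (taxicab-refl P)
taxicab-applyM (φ ∷ φs) P = ℕ.≤-trans (taxicab-step φ P (applyM φs P)) (ℕ.s≤s (taxicab-applyM φs P))

i*i≡+∣i∣*∣i∣ : ∀ i → i *ℤ i ≡ + (∣ i ∣ * ∣ i ∣)
i*i≡+∣i∣*∣i∣ (+ zero)   = refl
i*i≡+∣i∣*∣i∣ (+ suc n)  = refl
i*i≡+∣i∣*∣i∣ -[1+ n ]   = refl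

m*m+n*n≤[m+n]*[m+n] : ∀ m n → m * m + n * n ≤ (m + n) * (m + n)
m*m+n*n≤[m+n]*[m+n] m n = begin
  m * m + n * n                 ≤⟨ ℕ.+-mono-≤ (ℕ.*-monoʳ-≤ m (ℕ.m≤m+n m n)) (ℕ.*-monoʳ-≤ n (ℕ.m≤n+m n m)) ⟩
  m * (m + n) + n * (m + n)     ≡⟨ ℕ.*-distribʳ-+ (m + n) m n ⟨
  (m + n) * (m + n)             ∎
  where open ℕ.≤-Reasoning

dE²≤taxicab² : ∀ P Q → dE² P Q ≤ℤ + (taxicab P Q * taxicab P Q)
dE²≤taxicab² (x₁ , y₁) (x₂ , y₂) =
  subst (_≤ℤ + ((∣ Δx ∣ + ∣ Δy ∣) * (∣ Δx ∣ + ∣ Δy ∣)))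
        (sym (cong₂ _+ℤ_ (i*i≡+∣i∣*∣i∣ Δx) (i*i≡+∣i∣*∣i∣ Δy)))
        (+≤+ (m*m+n*n≤[m+n]*[m+n] ∣ Δx ∣ ∣ Δy ∣))
  where
  Δx Δy : ℤ
  Δx = x₁ -ℤ x₂
  Δy = y₁ -ℤ y₂

dE²≤dM² : ∀ P Q k → IsDM P Q k → dE² P Q ≤ℤ (+ k) *ℤ (+ k)
dE²≤dM² P Q k ((φs , refl , refl) , _) =
  subst (dE² P (applyM φs P) ≤ℤ_) (sym (i*i≡+∣i∣*∣i∣ (+ length φs)))
    (ℤ.≤-trans (dE²≤taxicab² P (applyM φs P)) (+≤+ (ℕ.*-mono-≤ (taxicab-applyM φs P) (taxicab-applyM φs P))))

proposition6p1 : IsMetricDpc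
    × (∀ P Q k → IsDM P Q k → dE² P Q ≤ℤ (+ k) *ℤ (+ k))
    × (∀ P Q a b → IsDpc P Q a → IsDM P Q b → a ≤ b)
proposition6p1 = isMetricDpc , dE²≤dM² , dpc≤dM
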